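{- Let $q\ge 3$ be a prime power and let $s,t$ be integers with $1\le s<t\le q$ and $t-s\ge 2$. Then there exists a linear AOA$(s,t,q+1,q)$.
   Context: An orthogonal array OA$(t,k,v)$ is a $v^t\times k$ array with entries from a set $X$ of size $v$ such that the restriction to any $t$ columns contains every $t$-tuple of $X^t$ exactly once. An AOA$(s,t,k,v)$ is a $v^t\times (k+1)$ array $A$ such that: (1) the first $k$ columns form an OA$(t,k,v)$ on a set $X$ with $|X|=v$; (2) the last column has symbols from a set $Y$ with $|Y|=v^{t-s}$; (3) any $s$ of the first $k$ columns together with the last column contain every $(s+1)$-tuple of $X^s\times Y$ exactly once. A linear AOA$(s,t,k,q)$ is an AOA$(s,t,k,q)$ with $X=\mathbb{F}_q$, $Y=\mathbb{F}_q^{t-s}$, whose set of rows, each regarded as a vector of $\mathbb{F}_q^{k+t-s}$ (first $k$ entries followed by the $t-s$ coordinates of the last entry), is a $t$-dimensional $\mathbb{F}_q$-subspace. -}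

module Defs where

open import Level using (0ℓ) renaming (suc to lsuc)
open import Data.Nat using (ℕ; _∸_)
open import Data.Fin using (Fin)
open import Data.Vec using (Vec; tabulate; lookup; zipWith; map; replicate)
open import Data.Product using (Σ; ∃; ∃-syntax; _×_; _,_; proj₁; proj₂)
open import Relation.Binary.PropositionalEquality using (_≡_)
open import Relation.Nullary using (¬_)
open import Algebra.Structures using (IsCommutativeRing)
open import Function.Bundles using (_↔_)
open import Function.Definitions using (Injective)

record FiniteField (q : ℕ) : Set₁ where
  field
    Carrier : Set
    _+_ _*_ : Carrier → Carrier → Carrier
    -_      : Carrier → Carrier
    0# 1#   : Carrier
    isCommutativeRing : IsCommutativeRing _≡_ _+_ _*_ -_ 0# 1#
    0≢1     : ¬ (0# ≡ 1#)
    inverse : ∀ x → ¬ (x ≡ 0#) → ∃[ y ] (x * y ≡ 1#)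
    card    : Carrier ↔ Fin q

∃!≡ : {A : Set} → (A → Set) → Set
∃!≡ {A} P = Σ A λ x → P x × (∀ y → P y → x ≡ y)

restrict : {A : Set} {k m : ℕ} → Vec A k → (Fin m → Fin k) → Vec A m
restrict v c = tabulate (λ i → lookup v (c i))

module _ {q : ℕ} (F : FiniteField q) where
  open FiniteField F

  _⊕_ : {n : ℕ} → Vec Carrier n → Vec Carrier n → Vec Carrier n
  u ⊕ v = zipWith _+_ u v

  _⊙_ : {n : ℕ} → Carrier → Vec Carrier n → Vec Carrier n
  a ⊙ v = map (a *_) v

  -- A row of a linear AOA(s,t,k,q): first k entries in F_q, last entry in F_q^(t-s).
  Row : (s t k : ℕ) → Set
  Row s t k = Vec Carrier k × Vec Carrier (t ∸ s)

  IsLinear : {s t k : ℕ} → (Vec Carrier t → Row s t k) → Set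
  IsLinear f =
      (∀ x y → proj₁ (f (x ⊕ y)) ≡ proj₁ (f x) ⊕ proj₁ (f y)
             × proj₂ (f (x ⊕ y)) ≡ proj₂ (f x) ⊕ proj₂ (f y))
    × (∀ a x → proj₁ (f (a ⊙ x)) ≡ a ⊙ proj₁ (f x)
             × proj₂ (f (a ⊙ x)) ≡ a ⊙ proj₂ (f x))

  -- The array whose q^t rows are f(x), x ∈ F_q^t, is an AOA(s,t,k,q):
  --  (1) first k columns form an OA(t,k,q): any t distinct columns contain every
  --      t-tuple exactly once;
  --  (3) any s distinct of the first k columns together with the last column
  --      contain every element of F_q^s × F_q^(t-s) exactly once.
  -- (2) is built into the type Row.
  IsAOA : (s t k : ℕ) → (Vec Carrier t → Row s t k) → Set
  IsAOA s t k f =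
      (∀ (c : Fin t → Fin k) → Injective _≡_ _≡_ c →
         ∀ (y : Vec Carrier t) → ∃!≡ λ x → restrict (proj₁ (f x)) c ≡ y)
    × (∀ (c : Fin s → Fin k) → Injective _≡_ _≡_ c →
         ∀ (y : Vec Carrier s) (z : Vec Carrier (t ∸ s)) →
           ∃!≡ λ x → restrict (proj₁ (f x)) c ≡ y × proj₂ (f x) ≡ z)

  -- A linear AOA(s,t,k,q): the row set is the image of an F_q-linear map
  -- F_q^t → F_q^(k+t-s), each x ∈ F_q^t giving one row (q^t rows).
  LinearAOA : (s t k : ℕ) → Set
  LinearAOA s t k = Σ (Vec Carrier t → Row s t k) λ f → IsLinear {s} {t} {k} f × IsAOA s t k f

-- Let d = t - s and let h be a monic polynomial of degree d without roots in F_q, e.g.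
-- h = X^d - X - κ for a value κ missed by a ↦ a^d - a. The row indexed by (g, r) ∈ F_q^s × F_q^d
-- lists the values of P = h g + X^s r, a polynomial of degree < t, at the q + 1 points of the
-- projective line (at ∞ a polynomial of degree < t takes its coefficient of X^(t-1)), followed by r.
-- Any t of these columns determine P, as a polynomial of degree < t vanishing at t points is zero,
-- and P determines (g, r) because h(0) ≠ 0. If s columns and r vanish, then P = h g, and as h is
-- monic without roots, g vanishes at s points and so g = 0. Everything is linear, so these kernel
-- computations give injectivity, and injective maps F_q^t → F_q^t are bijective.

module Submission where

open import Level using (0ℓ)
open import Algebra.Bundles using (CommutativeRing; Semiring)
open import Algebra.Core using (Op₁; Op₂)
open import Algebra.Structures using (IsCommutativeRing)
open import Data.Fin using (Fin; zero; suc; punchOut)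
open import Data.Fin.Properties
  using (any?; all?; ¬∀⟶∃¬; injective⇒≤; punchOut-injective; inj⇒≟; *↔×; suc-injective; 0≢1+n)
open import Data.Maybe using (Maybe; just; nothing)
open import Data.Maybe.Properties using (just-injective)
open import Data.Nat using (ℕ; suc; _≤_; _<_; _∸_; s≤s)
import Data.Nat as ℕ
open import Data.Nat.Properties using (1+n≰n; m+[n∸m]≡n; <⇒≤)
open import Data.Product using (Σ; ∃; _×_; _,_; proj₁; proj₂; uncurry)
open import Data.Product.Function.NonDependent.Propositional using (_×-↔_)
open import Data.Vec
  using (Vec; []; _∷_; _∷ʳ_; _++_; head; lookup; map; replicate; tabulate; take; drop; uncons; zipWith)
open import Data.Vec.Properties
  using (∷-injectiveˡ; ∷-injectiveʳ; ++-injective; lookup∘tabulate; lookup-map; lookup-replicate;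
         lookup-zipWith; map-++; tabulate-cong; tabulate-∘; take++drop≡id; take-map; take-zipWith;
         drop-map; drop-zipWith; zipWith-++)
open import Function using (_∘_)
open import Function.Bundles using (_↔_; Inverse; Injection; mk↔ₛ′)
open import Function.Definitions using (Injective)
open import Function.Properties.Inverse using (↔⇒↣; ↔-sym; ↔-trans)
open import Relation.Binary.Definitions using (DecidableEquality)
open import Relation.Binary.PropositionalEquality
open import Relation.Nullary using (Dec; yes; no; contradiction)
import Relation.Nullary.Decidable as Dec
open import Defs using (FiniteField; ∃!≡; restrict; LinearAOA)

Fin-injective⇒surjective : ∀ {n} {f : Fin n → Fin n} → Injective _≡_ _≡_ f →
                           ∀ y → ∃ λ x → f x ≡ y
Fin-injective⇒surjective {suc m} {f} f-inj y with any? (λ x → f x Data.Fin.≟ y)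
... | yes hit  = hit
... | no  miss = contradiction (injective⇒≤ punchOut∘f-injective) 1+n≰n
  where
  y≢f : ∀ x → y ≢ f x
  y≢f x y≡fx = miss (x , sym y≡fx)
  punchOut∘f : Fin (suc m) → Fin m
  punchOut∘f x = punchOut (y≢f x)
  punchOut∘f-injective : Injective _≡_ _≡_ punchOut∘f
  punchOut∘f-injective {x} {x′} = f-inj ∘ punchOut-injective (y≢f x) (y≢f x′)

module FiniteType {A : Set} {N : ℕ} (A↔Fin : A ↔ Fin N) where
  open Inverse A↔Fin using (to; from; strictlyInverseˡ; strictlyInverseʳ)

  to-injective : Injective _≡_ _≡_ to
  to-injective = Injection.injective (↔⇒↣ A↔Fin)

  injective⇒surjective : {f : A → A} → Injective _≡_ _≡_ f → ∀ y → ∃ λ x → f x ≡ y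
  injective⇒surjective {f} f-inj y =
    let i , hit = Fin-injective⇒surjective f′-injective (to y) in from i , to-injective hit
    where
    f′ : Fin N → Fin N
    f′ = to ∘ f ∘ from
    f′-injective : Injective _≡_ _≡_ f′
    f′-injective {i} {j} e =
      trans (sym (strictlyInverseˡ i)) (trans (cong to (f-inj (to-injective e))) (strictlyInverseˡ j))

  injective⇒∃! : {f : A → A} → Injective _≡_ _≡_ f → ∀ y → ∃!≡ λ x → f x ≡ y
  injective⇒∃! f-inj y =
    let x , fx≡y = injective⇒surjective f-inj y in
    x , fx≡y , λ x′ fx′≡y → f-inj (trans fx≡y (sym fx′≡y))

  surjective⇒injective : {f : A → A} → (∀ y → ∃ λ x → f x ≡ y) → Injective _≡_ _≡_ f
  surjective⇒injective {f} f-surj {x} {y} fx≡fy = trans (sym (g∘f x)) (trans (cong g fx≡fy) (g∘f y))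
    where
    g : A → A
    g = proj₁ ∘ f-surj
    f∘g : ∀ y → f (g y) ≡ y
    f∘g = proj₂ ∘ f-surj
    g-injective : Injective _≡_ _≡_ g
    g-injective {y} {y′} e = trans (sym (f∘g y)) (trans (cong f e) (f∘g y′))
    g∘f : ∀ x → g (f x) ≡ x
    g∘f x = let x′ , gx′≡x = injective⇒surjective g-injective x in
      trans (cong (g ∘ f) (sym gx′≡x)) (trans (cong g (f∘g x′)) gx′≡x)

  _≟_ : DecidableEquality A
  _≟_ = inj⇒≟ (↔⇒↣ A↔Fin)

  hasPreimage? : (f : A → A) → ∀ κ → Dec (∃ λ a → f a ≡ κ)
  hasPreimage? f κ = Dec.map′ (λ (i , e) → from i , e)
                              (λ (a , e) → to a , trans (cong f (strictlyInverseʳ a)) e)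
                              (any? λ i → f (from i) ≟ κ)

  nonInjective⇒missesValue : (f : A → A) {x y : A} → x ≢ y → f x ≡ f y → ∃ λ κ → ∀ a → f a ≢ κ
  nonInjective⇒missesValue f x≢y fx≡fy with all? (hasPreimage? f ∘ from)
  ... | yes allHit = contradiction (surjective⇒injective surjective fx≡fy) x≢y
    where
    surjective : ∀ κ → ∃ λ a → f a ≡ κ
    surjective κ = subst (λ κ → ∃ λ a → f a ≡ κ) (strictlyInverseʳ κ) (allHit (to κ))
  ... | no notAll = let i , missed = ¬∀⟶∃¬ N _ (hasPreimage? f ∘ from) notAll in
    from i , λ a fa≡κ → missed (a , fa≡κ)

Vec↔Fin^ : ∀ {A : Set} {N} → A ↔ Fin N → ∀ n → Vec A n ↔ Fin (N ℕ.^ n)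
Vec↔Fin^ A↔Fin 0       =
  mk↔ₛ′ (λ _ → zero) (λ _ → []) (λ { zero → refl ; (suc ()) }) (λ { [] → refl })
Vec↔Fin^ A↔Fin (suc n) = ↔-trans uncons↔ (↔-trans (A↔Fin ×-↔ Vec↔Fin^ A↔Fin n) (↔-sym *↔×))
  where
  uncons↔ : Vec _ (suc n) ↔ (_ × Vec _ n)
  uncons↔ = mk↔ₛ′ uncons (uncurry _∷_) (λ _ → refl) (λ { (x ∷ xs) → refl })

module Vectors {A : Set} {plus times : Op₂ A} {negate : Op₁ A} {0r 1r : A}
               (isCommutativeRing : IsCommutativeRing _≡_ plus times negate 0r 1r) where

  commutativeRing : CommutativeRing 0ℓ 0ℓ
  commutativeRing = record { isCommutativeRing = isCommutativeRing }

  open CommutativeRing commutativeRing public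
    using (_+_; _*_; -_; 0#; 1#; +-comm; +-identityˡ; +-identityʳ; *-comm; *-assoc;
           *-identityˡ; *-identityʳ; zeroˡ; zeroʳ; distribˡ; distribʳ; -‿inverseˡ; -‿inverseʳ; _-_)
  open CommutativeRing commutativeRing using (ring; +-abelianGroup; commutativeSemiring)
  open import Algebra.Properties.Ring ring using (-1*x≈-x)
  open import Algebra.Properties.AbelianGroup +-abelianGroup public using (x∙y⁻¹≈ε⇒x≈y)
  open import Algebra.Solver.Ring.NaturalCoefficients.Default commutativeSemiring
  open ≡-Reasoning

  private
    variable
      k m n : ℕ

  _⊕_ : Vec A n → Vec A n → Vec A n
  _⊕_ = zipWith _+_

  _⊙_ : A → Vec A n → Vec A n
  a ⊙ v = map (a *_) v

  _⊖_ : Vec A n → Vec A n → Vec A n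
  u ⊖ v = u ⊕ ((- 1#) ⊙ v)

  0ᵛ : Vec A n
  0ᵛ = replicate _ 0#

  0ᵛ++0ᵛ : 0ᵛ {m} ++ 0ᵛ {n} ≡ 0ᵛ
  0ᵛ++0ᵛ {0}     = refl
  0ᵛ++0ᵛ {suc m} = cong (0# ∷_) (0ᵛ++0ᵛ {m})

  x⊖x≡0ᵛ : (v : Vec A n) → v ⊖ v ≡ 0ᵛ
  x⊖x≡0ᵛ []      = refl
  x⊖x≡0ᵛ (a ∷ v) = cong₂ _∷_ (trans (cong (a +_) (-1*x≈-x a)) (-‿inverseʳ a)) (x⊖x≡0ᵛ v)

  x⊖y≡0ᵛ⇒x≡y : (u v : Vec A n) → u ⊖ v ≡ 0ᵛ → u ≡ v
  x⊖y≡0ᵛ⇒x≡y []      []      _ = refl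
  x⊖y≡0ᵛ⇒x≡y (a ∷ u) (b ∷ v) e = cong₂ _∷_
    (x∙y⁻¹≈ε⇒x≈y a b (trans (cong (a +_) (sym (-1*x≈-x b))) (∷-injectiveˡ e)))
    (x⊖y≡0ᵛ⇒x≡y u v (∷-injectiveʳ e))

  0⊙x⊕y≡y : (u v : Vec A n) → (0# ⊙ u) ⊕ v ≡ v
  0⊙x⊕y≡y []      []      = refl
  0⊙x⊕y≡y (a ∷ u) (b ∷ v) =
    cong₂ _∷_ (trans (cong (_+ b) (zeroˡ a)) (+-identityˡ b)) (0⊙x⊕y≡y u v)

  ∃!-++ : ∀ {X : Set} {f : X → Vec A m} {g : X → Vec A n} {y z} →
          ∃!≡ (λ x → f x ++ g x ≡ y ++ z) → ∃!≡ (λ x → f x ≡ y × g x ≡ z)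
  ∃!-++ {f = f} (x , fx++gx≡y++z , unique) =
    x , ++-injective (f x) _ fx++gx≡y++z ,
    λ x′ (fx′≡y , gx′≡z) → unique x′ (cong₂ _++_ fx′≡y gx′≡z)

  IsLinearFunctional : (Vec A m → A) → Set
  IsLinearFunctional φ = (∀ x y → φ (x ⊕ y) ≡ φ x + φ y) × (∀ a x → φ (a ⊙ x) ≡ a * φ x)

  IsLinearMap : (Vec A m → Vec A n) → Set
  IsLinearMap L = (∀ x y → L (x ⊕ y) ≡ L x ⊕ L y) × (∀ a x → L (a ⊙ x) ≡ a ⊙ L x)

  linearFunctional-cong : {φ ψ : Vec A m → A} → (∀ x → φ x ≡ ψ x) →
                          IsLinearFunctional ψ → IsLinearFunctional φ
  linearFunctional-cong {φ = φ} {ψ} φ≗ψ (additive , homogeneous) =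
      (λ x y → trans (φ≗ψ (x ⊕ y)) (trans (additive x y) (sym (cong₂ _+_ (φ≗ψ x) (φ≗ψ y)))))
    , (λ a x → trans (φ≗ψ (a ⊙ x)) (trans (homogeneous a x) (sym (cong (a *_) (φ≗ψ x)))))

  linearFunctional-0ᵛ : {φ : Vec A m → A} → IsLinearFunctional φ → φ 0ᵛ ≡ 0#
  linearFunctional-0ᵛ {φ = φ} (_ , homogeneous) = begin
    φ 0ᵛ          ≡⟨ cong φ (sym 0⊙0ᵛ) ⟩
    φ (0# ⊙ 0ᵛ)   ≡⟨ homogeneous 0# 0ᵛ ⟩
    0# * φ 0ᵛ     ≡⟨ zeroˡ _ ⟩
    0#            ∎
    where
    0⊙0ᵛ : ∀ {m} → 0# ⊙ 0ᵛ {m} ≡ 0ᵛ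
    0⊙0ᵛ {0}     = refl
    0⊙0ᵛ {suc m} = cong₂ _∷_ (zeroˡ 0#) 0⊙0ᵛ

  +-linear : {φ ψ : Vec A m → A} → IsLinearFunctional φ → IsLinearFunctional ψ →
             IsLinearFunctional (λ x → φ x + ψ x)
  +-linear {φ = φ} {ψ} (φ-add , φ-hom) (ψ-add , ψ-hom) =
      (λ x y → trans (cong₂ _+_ (φ-add x y) (ψ-add x y))
                     (solve 4 (λ a b c d → (a :+ b) :+ (c :+ d) := (a :+ c) :+ (b :+ d)) refl
                              (φ x) (φ y) (ψ x) (ψ y)))
    , (λ a x → trans (cong₂ _+_ (φ-hom a x) (ψ-hom a x)) (sym (distribˡ a (φ x) (ψ x))))

  *-linear : ∀ c {φ : Vec A m → A} → IsLinearFunctional φ → IsLinearFunctional (λ x → c * φ x)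
  *-linear c {φ} (φ-add , φ-hom) =
      (λ x y → trans (cong (c *_) (φ-add x y)) (distribˡ c (φ x) (φ y)))
    , (λ a x → trans (cong (c *_) (φ-hom a x))
                     (solve 3 (λ c a b → c :* (a :* b) := a :* (c :* b)) refl c a (φ x)))

  ∘-linear : {φ : Vec A n → A} {L : Vec A m → Vec A n} →
             IsLinearFunctional φ → IsLinearMap L → IsLinearFunctional (φ ∘ L)
  ∘-linear {φ = φ} {L} (φ-add , φ-hom) (L-add , L-hom) =
      (λ x y → trans (cong φ (L-add x y)) (φ-add (L x) (L y)))
    , (λ a x → trans (cong φ (L-hom a x)) (φ-hom a (L x)))

  lookup-linear : ∀ {L : Vec A m → Vec A n} i → IsLinearMap L → IsLinearFunctional (λ x → lookup (L x) i)
  lookup-linear {L = L} i (L-add , L-hom) =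
      (λ x y → trans (cong (λ v → lookup v i) (L-add x y)) (lookup-zipWith _+_ i (L x) (L y)))
    , (λ a x → trans (cong (λ v → lookup v i) (L-hom a x)) (lookup-map i (a *_) (L x)))

  tabulate-linear : {φ : Fin n → Vec A m → A} → (∀ i → IsLinearFunctional (φ i)) →
                    IsLinearMap (λ x → tabulate (λ i → φ i x))
  tabulate-linear {φ = φ} φ-lin =
      (λ x y → trans (tabulate-cong (λ i → proj₁ (φ-lin i) x y))
                     (tabulate-⊕ (λ i → φ i x) (λ i → φ i y)))
    , (λ a x → trans (tabulate-cong (λ i → proj₂ (φ-lin i) a x)) (tabulate-∘ (a *_) (λ i → φ i x)))
    where
    tabulate-⊕ : ∀ {n} (f g : Fin n → A) → tabulate (λ i → f i + g i) ≡ tabulate f ⊕ tabulate g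
    tabulate-⊕ {0}     f g = refl
    tabulate-⊕ {suc n} f g = cong (f zero + g zero ∷_) (tabulate-⊕ (f ∘ suc) (g ∘ suc))

  take-linear : IsLinearMap (take m {n})
  take-linear {m} = take-zipWith _+_ , λ a x → take-map (a *_) m x

  drop-linear : IsLinearMap (drop m {n})
  drop-linear {m} = drop-zipWith _+_ , λ a x → drop-map (a *_) m x

  ++-linear : {L : Vec A k → Vec A m} {M : Vec A k → Vec A n} →
              IsLinearMap L → IsLinearMap M → IsLinearMap (λ x → L x ++ M x)
  ++-linear {L = L} {M} (L-add , L-hom) (M-add , M-hom) =
      (λ x y → trans (cong₂ _++_ (L-add x y) (M-add x y)) (sym (zipWith-++ _+_ (L x) (M x) (L y) (M y))))
    , (λ a x → trans (cong₂ _++_ (L-hom a x) (M-hom a x)) (sym (map-++ (a *_) (L x) (M x))))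

  linear-injective : {L : Vec A m → Vec A n} → IsLinearMap L → (∀ x → L x ≡ 0ᵛ → x ≡ 0ᵛ) →
                     Injective _≡_ _≡_ L
  linear-injective {L = L} (L-add , L-hom) kernel {x} {y} Lx≡Ly = x⊖y≡0ᵛ⇒x≡y x y (kernel (x ⊖ y) (begin
    L (x ⊖ y)                  ≡⟨ L-add x _ ⟩
    L x ⊕ L ((- 1#) ⊙ y)       ≡⟨ cong (L x ⊕_) (L-hom (- 1#) y) ⟩
    L x ⊖ L y                  ≡⟨ cong (L x ⊖_) (sym Lx≡Ly) ⟩
    L x ⊖ L x                  ≡⟨ x⊖x≡0ᵛ (L x) ⟩
    0ᵛ                         ∎))

module Polynomials {A : Set} {plus times : Op₂ A} {negate : Op₁ A} {0r 1r : A}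
                   (isCommutativeRing : IsCommutativeRing _≡_ plus times negate 0r 1r) where

  open Vectors isCommutativeRing public
  open import Algebra.Solver.Ring.NaturalCoefficients.Default (CommutativeRing.commutativeSemiring commutativeRing)
  open import Algebra.Definitions (_≡_ {A = A}) using (AlmostLeftCancellative)
  open import Algebra.Definitions.RawSemiring (Semiring.rawSemiring (CommutativeRing.semiring commutativeRing))
    public using (_^_)
  open ≡-Reasoning

  private
    variable
      m n s d : ℕ

  -- Poly n: polynomials of degree < n, as coefficient vectors with the constant term first.
  Poly : ℕ → Set
  Poly = Vec A

  eval : Poly n → A → A
  eval []      a = 0#
  eval (c ∷ p) a = c + a * eval p a

  lead : Poly n → A
  lead []          = 0#
  lead (c ∷ [])    = c
  lead (c ∷ d ∷ p) = lead (d ∷ p)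

  -- The projective line: nothing is the point at infinity, where p : Poly n takes
  -- the value of its coefficient of X^(n - 1).
  value : Poly n → Maybe A → A
  value p nothing  = lead p
  value p (just a) = eval p a

  eval-linear : ∀ a → IsLinearFunctional {n} (λ p → eval p a)
  eval-linear a = additive , homogeneous
    where
    additive : (p p′ : Poly n) → eval (p ⊕ p′) a ≡ eval p a + eval p′ a
    additive []      []        = sym (+-identityˡ 0#)
    additive (c ∷ p) (c′ ∷ p′) = begin
      (c + c′) + a * eval (p ⊕ p′) a             ≡⟨ cong (λ e → (c + c′) + a * e) (additive p p′) ⟩
      (c + c′) + a * (eval p a + eval p′ a)      ≡⟨ solve 5 (λ c c′ a e e′ → (c :+ c′) :+ a :* (e :+ e′)
                                                                  := (c :+ a :* e) :+ (c′ :+ a :* e′))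
                                                         refl c c′ a (eval p a) (eval p′ a) ⟩
      (c + a * eval p a) + (c′ + a * eval p′ a)  ∎
    homogeneous : ∀ k (p : Poly n) → eval (k ⊙ p) a ≡ k * eval p a
    homogeneous k []      = sym (zeroʳ k)
    homogeneous k (c ∷ p) = begin
      k * c + a * eval (k ⊙ p) a  ≡⟨ cong (λ e → k * c + a * e) (homogeneous k p) ⟩
      k * c + a * (k * eval p a)  ≡⟨ solve 4 (λ k c a e → k :* c :+ a :* (k :* e) := k :* (c :+ a :* e))
                                           refl k c a (eval p a) ⟩
      k * (c + a * eval p a)      ∎

  lead-linear : IsLinearFunctional (lead {n})
  lead-linear = additive , homogeneous
    where
    additive : (p p′ : Poly n) → lead (p ⊕ p′) ≡ lead p + lead p′
    additive []          []             = sym (+-identityˡ 0#)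
    additive (c ∷ [])    (c′ ∷ [])      = refl
    additive (c ∷ d ∷ p) (c′ ∷ d′ ∷ p′) = additive (d ∷ p) (d′ ∷ p′)
    homogeneous : ∀ k (p : Poly n) → lead (k ⊙ p) ≡ k * lead p
    homogeneous k []          = sym (zeroʳ k)
    homogeneous k (c ∷ [])    = refl
    homogeneous k (c ∷ d ∷ p) = homogeneous k (d ∷ p)

  lead-∷ : ∀ c (p : Poly (suc n)) → lead (c ∷ p) ≡ lead p
  lead-∷ c (d ∷ p) = refl

  lead-0#∷ : (p : Poly n) → lead (0# ∷ p) ≡ lead p
  lead-0#∷ []      = refl
  lead-0#∷ (d ∷ p) = refl

  lead-∷ʳ : ∀ (p : Poly n) c → lead (p ∷ʳ c) ≡ c
  lead-∷ʳ []      c = refl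
  lead-∷ʳ (d ∷ p) c = trans (lead-∷ d (p ∷ʳ c)) (lead-∷ʳ p c)

  x+a*0≡x : ∀ x a → x + a * 0# ≡ x
  x+a*0≡x = solve 2 (λ x a → x :+ a :* con 0 := x) refl

  eval-∷ʳ0# : ∀ (p : Poly n) a → eval (p ∷ʳ 0#) a ≡ eval p a
  eval-∷ʳ0# []      a = x+a*0≡x 0# a
  eval-∷ʳ0# (c ∷ p) a = cong (λ e → c + a * e) (eval-∷ʳ0# p a)

  eval-0# : (p : Poly (suc n)) → eval p 0# ≡ head p
  eval-0# (c ∷ p) = trans (cong (c +_) (zeroˡ _)) (+-identityʳ c)

  eval-xⁿ : ∀ n a → eval (replicate n 0# ∷ʳ 1#) a ≡ a ^ n
  eval-xⁿ 0       a = x+a*0≡x 1# a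
  eval-xⁿ (suc n) a = trans (cong (λ e → 0# + a * e) (eval-xⁿ n a)) (+-identityˡ _)

  1^n≡1 : ∀ n → 1# ^ n ≡ 1#
  1^n≡1 0       = refl
  1^n≡1 (suc n) = trans (*-identityˡ _) (1^n≡1 n)

  dropLead : Poly (suc n) → Poly n
  dropLead (c ∷ [])    = []
  dropLead (c ∷ d ∷ p) = c ∷ dropLead (d ∷ p)

  eval-dropLead : ∀ (p : Poly (suc n)) a → lead p ≡ 0# → eval (dropLead p) a ≡ eval p a
  eval-dropLead (c ∷ [])    a c≡0    = sym (trans (x+a*0≡x c a) c≡0)
  eval-dropLead (c ∷ d ∷ p) a lead≡0 = cong (λ e → c + a * e) (eval-dropLead (d ∷ p) a lead≡0)

  dropLead≡0ᵛ⇒≡0ᵛ : ∀ (p : Poly (suc n)) → lead p ≡ 0# → dropLead p ≡ 0ᵛ → p ≡ 0ᵛ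
  dropLead≡0ᵛ⇒≡0ᵛ (c ∷ [])    c≡0    _ = cong (_∷ []) c≡0
  dropLead≡0ᵛ⇒≡0ᵛ (c ∷ d ∷ p) lead≡0 e =
    cong₂ _∷_ (∷-injectiveˡ e) (dropLead≡0ᵛ⇒≡0ᵛ (d ∷ p) lead≡0 (∷-injectiveʳ e))

  value-dropLead : ∀ (p : Poly (suc n)) z → lead p ≡ 0# → z ≢ nothing → value (dropLead p) z ≡ value p z
  value-dropLead p nothing  _      z≢∞ = contradiction refl z≢∞
  value-dropLead p (just a) lead≡0 _   = eval-dropLead p a lead≡0

  -- Synthetic division by X - a; the remainder is eval p a.
  quotient : A → Poly (suc n) → Poly n
  quotient a (c ∷ [])    = []
  quotient a (c ∷ d ∷ p) = eval (d ∷ p) a ∷ quotient a (d ∷ p)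

  -- p(b) - p(a) = (b - a) q(b), with both sides moved so that no subtraction occurs.
  eval-quotient : ∀ (p : Poly (suc n)) a b →
                  eval p b + a * eval (quotient a p) b ≡ b * eval (quotient a p) b + eval p a
  eval-quotient (c ∷ [])    a b = solve 3 (λ c a b → (c :+ b :* con 0) :+ a :* con 0
                                                     := b :* con 0 :+ (c :+ a :* con 0)) refl c a b
  eval-quotient (c ∷ d ∷ p) a b = begin
    (c + b * P) + a * (E + b * Q)  ≡⟨ solve 6 (λ c b P a E Q → (c :+ b :* P) :+ a :* (E :+ b :* Q)
                                                  := (c :+ a :* E) :+ b :* (P :+ a :* Q)) refl c b P a E Q ⟩
    (c + a * E) + b * (P + a * Q)  ≡⟨ cong (λ x → (c + a * E) + b * x) (eval-quotient (d ∷ p) a b) ⟩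
    (c + a * E) + b * (b * Q + E)  ≡⟨ solve 5 (λ c b a E Q → (c :+ a :* E) :+ b :* (b :* Q :+ E)
                                                  := b :* (E :+ b :* Q) :+ (c :+ a :* E)) refl c b a E Q ⟩
    b * (E + b * Q) + (c + a * E)  ∎
    where
    P = eval (d ∷ p) b
    E = eval (d ∷ p) a
    Q = eval (quotient a (d ∷ p)) b

  lead-quotient : ∀ (p : Poly (suc (suc n))) a → lead (quotient a p) ≡ lead p
  lead-quotient (c ∷ d ∷ [])    a = x+a*0≡x d a
  lead-quotient (c ∷ d ∷ e ∷ p) a = lead-quotient (d ∷ e ∷ p) a

  quotient≡0ᵛ⇒≡0ᵛ : ∀ (p : Poly (suc n)) a → quotient a p ≡ 0ᵛ → eval p a ≡ 0# → p ≡ 0ᵛ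
  quotient≡0ᵛ⇒≡0ᵛ (c ∷ [])    a _ pa≡0 = cong (_∷ []) (trans (sym (x+a*0≡x c a)) pa≡0)
  quotient≡0ᵛ⇒≡0ᵛ (c ∷ d ∷ p) a q≡0 pa≡0 = cong₂ _∷_
    (trans (sym (x+a*0≡x c a)) (trans (cong (λ e → c + a * e) (sym E≡0)) pa≡0))
    (quotient≡0ᵛ⇒≡0ᵛ (d ∷ p) a (∷-injectiveʳ q≡0) E≡0)
    where
    E≡0 : eval (d ∷ p) a ≡ 0#
    E≡0 = ∷-injectiveˡ q≡0

  extend : ∀ k → Poly (suc n) → Poly (suc (k ℕ.+ n))
  extend 0       p = p
  extend (suc k) p = extend k p ∷ʳ 0#

  eval-extend : ∀ k (p : Poly (suc n)) a → eval (extend k p) a ≡ eval p a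
  eval-extend 0       p a = refl
  eval-extend (suc k) p a = trans (eval-∷ʳ0# (extend k p) a) (eval-extend k p a)

  head-extend : ∀ k (p : Poly (suc n)) → head (extend k p) ≡ head p
  head-extend 0       p = refl
  head-extend (suc k) p = trans (head-∷ʳ (extend k p)) (head-extend k p)
    where
    head-∷ʳ : (v : Vec A (suc m)) → head (v ∷ʳ 0#) ≡ head v
    head-∷ʳ (x ∷ v) = refl

  mulAdd : Poly (suc d) → Poly s → Poly d → Poly (s ℕ.+ d)
  mulAdd             h []      r = r
  mulAdd {s = suc s} h (c ∷ g) r = (c ⊙ extend s h) ⊕ (0# ∷ mulAdd h g r)

  eval-mulAdd : ∀ (h : Poly (suc d)) (g : Poly s) r a →
                eval (mulAdd h g r) a ≡ eval h a * eval g a + a ^ s * eval r a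
  eval-mulAdd h [] r a = solve 2 (λ H R → R := H :* con 0 :+ con 1 :* R) refl (eval h a) (eval r a)
  eval-mulAdd {s = suc s} h (c ∷ g) r a = begin
    eval ((c ⊙ extend s h) ⊕ (0# ∷ M)) a           ≡⟨ proj₁ (eval-linear a) (c ⊙ extend s h) (0# ∷ M) ⟩
    eval (c ⊙ extend s h) a + (0# + a * eval M a)  ≡⟨ cong₂ (λ x y → x + (0# + a * y))
                                                            eval-c⊙h (eval-mulAdd h g r a) ⟩
    c * H + (0# + a * (H * G + Aˢ * R))            ≡⟨ solve 6 (λ c H a G Aˢ R →
                                                                c :* H :+ (con 0 :+ a :* (H :* G :+ Aˢ :* R))
                                                                := H :* (c :+ a :* G) :+ (a :* Aˢ) :* R)
                                                              refl c H a G Aˢ R ⟩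
    H * (c + a * G) + (a * Aˢ) * R                 ∎
    where
    M = mulAdd h g r
    H = eval h a
    G = eval g a
    Aˢ = a ^ s
    R = eval r a
    eval-c⊙h : eval (c ⊙ extend s h) a ≡ c * H
    eval-c⊙h = trans (proj₂ (eval-linear a) c (extend s h)) (cong (c *_) (eval-extend s h a))

  lead-⊙⊕0#∷ : ∀ c (p : Poly (suc n)) q → lead ((c ⊙ p) ⊕ (0# ∷ q)) ≡ c * lead p + lead q
  lead-⊙⊕0#∷ c p q =
    trans (proj₁ lead-linear (c ⊙ p) (0# ∷ q)) (cong₂ _+_ (proj₂ lead-linear c p) (lead-0#∷ q))

  lead-mulAdd : ∀ (h : Poly (suc d)) → lead h ≡ 1# → ∀ (g : Poly s) r →
                lead (mulAdd h g r) ≡ lead g + lead r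
  lead-mulAdd h _       []          r = sym (+-identityˡ (lead r))
  lead-mulAdd h h-monic (c ∷ [])    r = begin
    lead ((c ⊙ h) ⊕ (0# ∷ r))  ≡⟨ lead-⊙⊕0#∷ c h r ⟩
    c * lead h + lead r        ≡⟨ cong (λ x → c * x + lead r) h-monic ⟩
    c * 1# + lead r            ≡⟨ cong (_+ lead r) (*-identityʳ c) ⟩
    c + lead r                 ∎
  lead-mulAdd {s = suc (suc s)} h h-monic (c ∷ d ∷ g) r = begin
    lead ((c ⊙ extend (suc s) h) ⊕ (0# ∷ M))  ≡⟨ lead-⊙⊕0#∷ c (extend (suc s) h) M ⟩
    c * lead (extend (suc s) h) + lead M      ≡⟨ cong (λ x → c * x + lead M) (lead-∷ʳ (extend s h) 0#) ⟩
    c * 0# + lead M                           ≡⟨ trans (cong (_+ lead M) (zeroʳ c)) (+-identityˡ _) ⟩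
    lead M                                    ≡⟨ lead-mulAdd h h-monic (d ∷ g) r ⟩
    lead (d ∷ g) + lead r                     ∎
    where
    M = mulAdd h (d ∷ g) r

  value∘mulAdd-linear : ∀ (h : Poly (suc d)) → lead h ≡ 1# → ∀ z →
                        IsLinearFunctional (λ (x : Vec A (s ℕ.+ d)) → value (mulAdd h (take s x) (drop s x)) z)
  value∘mulAdd-linear {s = s} h h-monic nothing =
    linearFunctional-cong (λ x → lead-mulAdd h h-monic (take s x) (drop s x))
      (+-linear (∘-linear lead-linear (take-linear {s})) (∘-linear lead-linear (drop-linear {s})))
  value∘mulAdd-linear {s = s} h h-monic (just a) =
    linearFunctional-cong (λ x → eval-mulAdd h (take s x) (drop s x) a)
      (+-linear (*-linear (eval h a) (∘-linear (eval-linear a) (take-linear {s})))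
                (*-linear (a ^ s) (∘-linear (eval-linear a) (drop-linear {s}))))

  module _ (*-cancelˡ-nonZero : AlmostLeftCancellative 0# _*_) where

    x*y≡0⇒y≡0 : ∀ {x y} → x ≢ 0# → x * y ≡ 0# → y ≡ 0#
    x*y≡0⇒y≡0 {x} {y} x≢0 xy≡0 = *-cancelˡ-nonZero x y 0# x≢0 (trans xy≡0 (sym (zeroʳ x)))

    ax≡bx⇒x≡0 : ∀ {a b x} → a ≢ b → a * x ≡ b * x → x ≡ 0#
    ax≡bx⇒x≡0 {a} {b} {x} a≢b ax≡bx = x*y≡0⇒y≡0 (a≢b ∘ x∙y⁻¹≈ε⇒x≈y a b) (begin
      (a - b) * x        ≡⟨ distribʳ x a (- b) ⟩
      a * x + (- b) * x  ≡⟨ cong (_+ (- b) * x) ax≡bx ⟩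
      b * x + (- b) * x  ≡⟨ sym (distribʳ x b (- b)) ⟩
      (b - b) * x        ≡⟨ cong (_* x) (-‿inverseʳ b) ⟩
      0# * x             ≡⟨ zeroˡ x ⟩
      0#                 ∎)

    value-quotient : ∀ (p : Poly (suc n)) a z → eval p a ≡ 0# → z ≢ just a →
                     value p z ≡ 0# → value (quotient a p) z ≡ 0#
    value-quotient (c ∷ [])    a nothing  _    _   _      = refl
    value-quotient (c ∷ d ∷ p) a nothing  _    _   lead≡0 = trans (lead-quotient (c ∷ d ∷ p) a) lead≡0
    value-quotient p           a (just b) pa≡0 b≢a pb≡0   = ax≡bx⇒x≡0 (b≢a ∘ cong just) (begin
      b * Q             ≡⟨ sym (+-identityʳ _) ⟩
      b * Q + 0#        ≡⟨ cong (b * Q +_) (sym pa≡0) ⟩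
      b * Q + eval p a  ≡⟨ sym (eval-quotient p a b) ⟩
      eval p b + a * Q  ≡⟨ cong (_+ a * Q) pb≡0 ⟩
      0# + a * Q        ≡⟨ +-identityˡ _ ⟩
      a * Q             ∎)
      where
      Q = eval (quotient a p) b

    vanishesOnDistinct⇒≡0ᵛ : (p : Poly n) (z : Fin n → Maybe A) → Injective _≡_ _≡_ z →
                              (∀ i → value p (z i) ≡ 0#) → p ≡ 0ᵛ
    vanishesOnDistinct⇒≡0ᵛ             []  z _     _        = refl
    vanishesOnDistinct⇒≡0ᵛ {n = suc n} p z z-inj vanishes = split (z zero) refl
      where
      z∘suc-injective : Injective _≡_ _≡_ (z ∘ suc)
      z∘suc-injective e = suc-injective (z-inj e)
      z∘suc≢ : ∀ {z₀} → z zero ≡ z₀ → ∀ i → z (suc i) ≢ z₀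
      z∘suc≢ z₀≡ i zᵢ≡z₀ = 0≢1+n (z-inj (trans z₀≡ (sym zᵢ≡z₀)))
      split : ∀ z₀ → z zero ≡ z₀ → p ≡ 0ᵛ
      split nothing  z₀≡ = dropLead≡0ᵛ⇒≡0ᵛ p lead≡0
        (vanishesOnDistinct⇒≡0ᵛ (dropLead p) (z ∘ suc) z∘suc-injective
          λ i → trans (value-dropLead p (z (suc i)) lead≡0 (z∘suc≢ z₀≡ i)) (vanishes (suc i)))
        where
        lead≡0 : lead p ≡ 0#
        lead≡0 = subst (λ w → value p w ≡ 0#) z₀≡ (vanishes zero)
      split (just a) z₀≡ = quotient≡0ᵛ⇒≡0ᵛ p a
        (vanishesOnDistinct⇒≡0ᵛ (quotient a p) (z ∘ suc) z∘suc-injective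
          λ i → value-quotient p a (z (suc i)) pa≡0 (z∘suc≢ z₀≡ i) (vanishes (suc i))) pa≡0
        where
        pa≡0 : eval p a ≡ 0#
        pa≡0 = subst (λ w → value p w ≡ 0#) z₀≡ (vanishes zero)

    mulAdd≡0ᵛ⇒ : ∀ (h : Poly (suc d)) → eval h 0# ≢ 0# → ∀ (g : Poly s) r →
                 mulAdd h g r ≡ 0ᵛ → g ≡ 0ᵛ × r ≡ 0ᵛ
    mulAdd≡0ᵛ⇒ h _ [] r r≡0 = refl , r≡0
    mulAdd≡0ᵛ⇒ {s = suc s} h h₀≢0 (c ∷ g) r eq =
      let c≡0 , M≡0 = constantTerm (extend s h) (head-extend s h) eq
          g≡0 , r≡0 = mulAdd≡0ᵛ⇒ h h₀≢0 g r M≡0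
      in cong₂ _∷_ c≡0 g≡0 , r≡0
      where
      M = mulAdd h g r
      constantTerm : ∀ (E : Poly (suc (s ℕ.+ _))) → head E ≡ head h → (c ⊙ E) ⊕ (0# ∷ M) ≡ 0ᵛ →
                     c ≡ 0# × M ≡ 0ᵛ
      constantTerm (e ∷ E) e≡h₀ eq = c≡0 , trans (sym (0⊙x⊕y≡y E M))
                                                 (subst (λ x → (x ⊙ E) ⊕ M ≡ 0ᵛ) c≡0 (∷-injectiveʳ eq))
        where
        c≡0 : c ≡ 0#
        c≡0 = x*y≡0⇒y≡0 (λ e≡0 → h₀≢0 (trans (eval-0# h) (trans (sym e≡h₀) e≡0)))
                        (trans (*-comm e c) (trans (sym (+-identityʳ _)) (∷-injectiveˡ eq)))

    value-h*g≡0⇒value-g≡0 : ∀ (h : Poly (suc d)) → lead h ≡ 1# → (∀ a → eval h a ≢ 0#) →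
                             ∀ (g : Poly s) z → value (mulAdd h g 0ᵛ) z ≡ 0# → value g z ≡ 0#
    value-h*g≡0⇒value-g≡0 {d = d} h h-monic _ g nothing vanishes = begin
      lead g                  ≡⟨ sym (+-identityʳ _) ⟩
      lead g + 0#             ≡⟨ cong (lead g +_) (sym (linearFunctional-0ᵛ {m = d} lead-linear)) ⟩
      lead g + lead (0ᵛ {d})  ≡⟨ sym (lead-mulAdd h h-monic g 0ᵛ) ⟩
      lead (mulAdd h g 0ᵛ)    ≡⟨ vanishes ⟩
      0#                      ∎
    value-h*g≡0⇒value-g≡0 {d = d} {s = s} h _ h-rootless g (just a) vanishes =
      x*y≡0⇒y≡0 (h-rootless a) (begin
        H * G                          ≡⟨ sym (+-identityʳ _) ⟩
        H * G + 0#                     ≡⟨ cong (H * G +_) (sym (zeroʳ (a ^ s))) ⟩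
        H * G + a ^ s * 0#             ≡⟨ cong (λ x → H * G + a ^ s * x)
                                               (sym (linearFunctional-0ᵛ {m = d} (eval-linear a))) ⟩
        H * G + a ^ s * eval (0ᵛ {d}) a ≡⟨ sym (eval-mulAdd h g 0ᵛ a) ⟩
        eval (mulAdd h g 0ᵛ) a         ≡⟨ vanishes ⟩
        0#                             ∎)
      where
      H = eval h a
      G = eval g a

module _ {q : ℕ} (F : FiniteField q) where

  open FiniteField F using (Carrier; isCommutativeRing; 0≢1; inverse; card)
  open Polynomials isCommutativeRing
  open import Algebra.Definitions (_≡_ {A = Carrier}) using (AlmostLeftCancellative)
  open ≡-Reasoning

  -- IsAOA and LinearAOA with the length t ∸ s of the last column generalised to u,
  -- so that t = s + u can hold definitionally.
  IsAOA′ : (s t u k : ℕ) → (Vec Carrier t → Vec Carrier k × Vec Carrier u) → Set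
  IsAOA′ s t u k f =
      (∀ (c : Fin t → Fin k) → Injective _≡_ _≡_ c →
         ∀ (y : Vec Carrier t) → ∃!≡ λ x → restrict (proj₁ (f x)) c ≡ y)
    × (∀ (c : Fin s → Fin k) → Injective _≡_ _≡_ c →
         ∀ (y : Vec Carrier s) (z : Vec Carrier u) →
           ∃!≡ λ x → restrict (proj₁ (f x)) c ≡ y × proj₂ (f x) ≡ z)

  LinearAOA′ : (s t u k : ℕ) → Set
  LinearAOA′ s t u k = Σ (Vec Carrier t → Vec Carrier k × Vec Carrier u) λ f →
    (IsLinearMap (proj₁ ∘ f) × IsLinearMap (proj₂ ∘ f)) × IsAOA′ s t u k f

  toLinearAOA : ∀ {s t k} → LinearAOA′ s t (t ∸ s) k → LinearAOA F s t k
  toLinearAOA (f , ((add₁ , hom₁) , (add₂ , hom₂)) , aoa) =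
    f , ((λ x y → add₁ x y , add₂ x y) , (λ a x → hom₁ a x , hom₂ a x)) , aoa

  *-cancelˡ-nonZero : AlmostLeftCancellative 0# _*_
  *-cancelˡ-nonZero x y z x≢0 xy≡xz with inverse x x≢0
  ... | x⁻¹ , xx⁻¹≡1 = begin
    y                 ≡⟨ sym (*-identityˡ y) ⟩
    1# * y            ≡⟨ cong (_* y) (sym (trans (*-comm x⁻¹ x) xx⁻¹≡1)) ⟩
    (x⁻¹ * x) * y     ≡⟨ *-assoc x⁻¹ x y ⟩
    x⁻¹ * (x * y)     ≡⟨ cong (x⁻¹ *_) xy≡xz ⟩
    x⁻¹ * (x * z)     ≡⟨ sym (*-assoc x⁻¹ x z) ⟩
    (x⁻¹ * x) * z     ≡⟨ cong (_* z) (trans (*-comm x⁻¹ x) xx⁻¹≡1) ⟩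
    1# * z            ≡⟨ *-identityˡ z ⟩
    z                 ∎

  -- h = X^(e+2) - X - κ, where κ is a value missed by a ↦ a^(e+2) - a: this map is not
  -- injective (it vanishes at 0 and 1), so on a finite field it is not surjective.
  monicRootless : ∀ e → ∃ λ (h : Poly (3 ℕ.+ e)) → lead h ≡ 1# × (∀ a → eval h a ≢ 0#)
  monicRootless e = (- κ) ∷ p , lead-h , rootless
    where
    p : Poly (2 ℕ.+ e)
    p = (- 1#) ∷ (replicate e 0# ∷ʳ 1#)
    φ : Carrier → Carrier
    φ a = a * eval p a
    φ0≡φ1 : φ 0# ≡ φ 1#
    φ0≡φ1 = begin
      0# * eval p 0#                                ≡⟨ zeroˡ _ ⟩
      0#                                            ≡⟨ sym (-‿inverseˡ 1#) ⟩
      - 1# + 1#                                     ≡⟨ cong (- 1# +_) (sym (trans (*-identityˡ _)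
                                                         (trans (eval-xⁿ e 1#) (1^n≡1 e)))) ⟩
      - 1# + 1# * eval (replicate e 0# ∷ʳ 1#) 1#    ≡⟨ sym (*-identityˡ _) ⟩
      1# * eval p 1#                                ∎
    missed : ∃ λ κ → ∀ a → φ a ≢ κ
    missed = FiniteType.nonInjective⇒missesValue card φ 0≢1 φ0≡φ1
    κ : Carrier
    κ = proj₁ missed
    lead-h : lead ((- κ) ∷ p) ≡ 1#
    lead-h = trans (lead-∷ (- κ) p)
                   (trans (lead-∷ (- 1#) (replicate e 0# ∷ʳ 1#)) (lead-∷ʳ (replicate e 0#) 1#))
    rootless : ∀ a → eval ((- κ) ∷ p) a ≢ 0#
    rootless a -κ+φa≡0 =
      proj₂ missed a (x∙y⁻¹≈ε⇒x≈y (φ a) κ (trans (+-comm (φ a) (- κ)) -κ+φa≡0))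

  point : Fin (suc q) → Maybe Carrier
  point zero    = nothing
  point (suc j) = just (Inverse.from card j)

  point-injective : Injective _≡_ _≡_ point
  point-injective {zero}  {zero}  _ = refl
  point-injective {suc i} {suc j} e = cong suc (Injection.injective (↔⇒↣ (↔-sym card)) (just-injective e))

  point∘-injective : ∀ {m} (c : Fin m → Fin (suc q)) → Injective _≡_ _≡_ c →
                     Injective _≡_ _≡_ (point ∘ c)
  point∘-injective c c-inj e = c-inj (point-injective e)

  module DoublyExtendedReedSolomon {d} (h : Poly (suc d)) (h-monic : lead h ≡ 1#)
                                   (h-rootless : ∀ a → eval h a ≢ 0#) (s : ℕ) where

    poly : Vec Carrier (s ℕ.+ d) → Poly (s ℕ.+ d)
    poly x = mulAdd h (take s x) (drop s x)

    columns : Vec Carrier (s ℕ.+ d) → Vec Carrier (suc q)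
    columns x = tabulate (λ j → value (poly x) (point j))

    columns-linear : IsLinearMap columns
    columns-linear = tabulate-linear (λ j → value∘mulAdd-linear h h-monic (point j))

    restrict-columns-linear : ∀ {m} (c : Fin m → Fin (suc q)) → IsLinearMap (λ x → restrict (columns x) c)
    restrict-columns-linear c = tabulate-linear (λ i → lookup-linear (c i) columns-linear)

    restrict-columns≡0ᵛ : ∀ {m} x (c : Fin m → Fin (suc q)) → restrict (columns x) c ≡ 0ᵛ →
                          ∀ i → value (poly x) (point (c i)) ≡ 0#
    restrict-columns≡0ᵛ x c e i = begin
      value (poly x) (point (c i))       ≡⟨ sym (lookup∘tabulate (λ j → value (poly x) (point j)) (c i)) ⟩
      lookup (columns x) (c i)           ≡⟨ sym (lookup∘tabulate (lookup (columns x) ∘ c) i) ⟩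
      lookup (restrict (columns x) c) i  ≡⟨ cong (λ v → lookup v i) e ⟩
      lookup 0ᵛ i                        ≡⟨ lookup-replicate i 0# ⟩
      0#                                 ∎

    take-drop≡0ᵛ : ∀ (x : Vec Carrier (s ℕ.+ d)) → take s x ≡ 0ᵛ → drop s x ≡ 0ᵛ → x ≡ 0ᵛ
    take-drop≡0ᵛ x take≡0 drop≡0 =
      trans (sym (take++drop≡id s x)) (trans (cong₂ _++_ take≡0 drop≡0) (0ᵛ++0ᵛ {s}))

    restrict-columns-kernel : (c : Fin (s ℕ.+ d) → Fin (suc q)) → Injective _≡_ _≡_ c →
                              ∀ x → restrict (columns x) c ≡ 0ᵛ → x ≡ 0ᵛ
    restrict-columns-kernel c c-inj x e = uncurry (take-drop≡0ᵛ x)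
      (mulAdd≡0ᵛ⇒ *-cancelˡ-nonZero h (h-rootless 0#) (take s x) (drop s x)
        (vanishesOnDistinct⇒≡0ᵛ *-cancelˡ-nonZero (poly x) (point ∘ c) (point∘-injective c c-inj)
          (restrict-columns≡0ᵛ x c e)))

    restrict-columns++drop-kernel : (c : Fin s → Fin (suc q)) → Injective _≡_ _≡_ c →
                                    ∀ x → restrict (columns x) c ++ drop s x ≡ 0ᵛ → x ≡ 0ᵛ
    restrict-columns++drop-kernel c c-inj x e = take-drop≡0ᵛ x take≡0 drop≡0
      where
      split : restrict (columns x) c ≡ 0ᵛ × drop s x ≡ 0ᵛ
      split = ++-injective (restrict (columns x) c) 0ᵛ (trans e (sym (0ᵛ++0ᵛ {s})))
      drop≡0 : drop s x ≡ 0ᵛ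
      drop≡0 = proj₂ split
      take≡0 : take s x ≡ 0ᵛ
      take≡0 = vanishesOnDistinct⇒≡0ᵛ *-cancelˡ-nonZero (take s x) (point ∘ c) (point∘-injective c c-inj)
        λ i → value-h*g≡0⇒value-g≡0 *-cancelˡ-nonZero h h-monic h-rootless (take s x) (point (c i))
                (subst (λ r → value (mulAdd h (take s x) r) (point (c i)) ≡ 0#) drop≡0
                       (restrict-columns≡0ᵛ x c (proj₁ split) i))

    restrict-columns-injective : (c : Fin (s ℕ.+ d) → Fin (suc q)) → Injective _≡_ _≡_ c →
                                 Injective _≡_ _≡_ (λ x → restrict (columns x) c)
    restrict-columns-injective c c-inj =
      linear-injective (restrict-columns-linear c) (restrict-columns-kernel c c-inj)

    restrict-columns++drop-injective : (c : Fin s → Fin (suc q)) → Injective _≡_ _≡_ c →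
                                       Injective _≡_ _≡_ (λ x → restrict (columns x) c ++ drop s x)
    restrict-columns++drop-injective c c-inj =
      linear-injective (++-linear (restrict-columns-linear c) drop-linear) (restrict-columns++drop-kernel c c-inj)

    linearAOA′ : LinearAOA′ s (s ℕ.+ d) d (suc q)
    linearAOA′ = (λ x → columns x , drop s x) , (columns-linear , drop-linear)
               , (λ c c-inj → injective⇒∃! (restrict-columns-injective c c-inj))
               , (λ c c-inj y z → ∃!-++ (injective⇒∃! (restrict-columns++drop-injective c c-inj) (y ++ z)))
      where
      open FiniteType (Vec↔Fin^ card (s ℕ.+ d))

  linearAOA : ∀ s d → 2 ≤ d → LinearAOA′ s (s ℕ.+ d) d (suc q)
  linearAOA s 1             (s≤s ())
  linearAOA s (suc (suc e)) _ =
    let h , h-monic , h-rootless = monicRootless e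
    in DoublyExtendedReedSolomon.linearAOA′ h h-monic h-rootless s

theorem3p7 : (q : ℕ) → 3 ≤ q → (F : FiniteField q) →
    (s t : ℕ) → 1 ≤ s → s < t → t ≤ q → 2 ≤ t ∸ s →
    LinearAOA F s t (suc q)
theorem3p7 q _ F s t _ s<t _ 2≤t∸s =
  toLinearAOA F (subst (λ t′ → LinearAOA′ F s t′ (t ∸ s) (suc q))
                       (m+[n∸m]≡n (<⇒≤ s<t))
                       (linearAOA F s (t ∸ s) 2≤t∸s))
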